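{- Let $\bm\lambda=(R_1,\dots,R_n)$ ($n\ge3$) be a horizontal-strip with $l(R_1)<l(R_3)$ and $R_1\nleftrightarrow R_3$. Let $\bm\mu=(S_1,\dots,S_n)$ be a horizontal-strip and $\varphi:\Pi(\bm\lambda)\to\Pi(\bm\mu)$ an isomorphism such that $\varphi_1<\varphi_3$, $l(S_{\varphi_1})<l(S_{\varphi_3})$, and $S_{\varphi_1}\nleftrightarrow S_{\varphi_3}$. Then: if $l(R_2)>l(R_1)$ and $R_1\nleftrightarrow R_2$, then $l(S_{\varphi_2})>l(S_{\varphi_1})$; and if $l(R_3)>l(R_2)$ and $R_2\nleftrightarrow R_3$, then $l(S_{\varphi_3})>l(S_{\varphi_2})$.
   Context: A row is $R=a/b=\{(1,j):b+1\le j\le a\}$ ($a\ge b\ge0$ integers); $l(R)=b$, $|R|$ its number of cells, $R^+=(a+1)/(b+1)$. For rows $R,R'$: $M(R,R')=|R\cap R'|$ if $l(R)\le l(R')$, else $|R\cap R'^+|$. Rows commute, $R\leftrightarrow R'$, if $M(R,R')=M(R',R)$, else $R\nleftrightarrow R'$. A horizontal-strip is a sequence of rows; $M_{i,j}=M(R_{\min(i,j)},R_{\max(i,j)})$ for $i\ne j$. An isomorphism $\varphi:\Pi(\bm\lambda)\to\Pi(\bm\mu)$ is a permutation of $\{1,\dots,n\}$ with $|R_t|=|S_{\varphi_t}|$ for all $t$ and $M_{s,t}(\bm\lambda)=M_{\varphi_s,\varphi_t}(\bm\mu)$ for all $s\ne t$. -}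

module Defs where

open import Data.Nat using (ℕ; zero; suc; _∸_; _≤_; _<_; _⊔_; _⊓_)
open import Data.Nat.Properties using (_≤?_)
open import Data.Fin using (Fin; toℕ)
open import Data.Product using (_×_)
open import Relation.Binary.PropositionalEquality using (_≡_)
open import Relation.Nullary using (¬_; yes; no)
open import Function.Bundles using (_↔_; Inverse)

-- A row a/b = {(1,j) : b+1 ≤ j ≤ a} with a ≥ b ≥ 0.
record Row : Set where
  constructor _/_∣_
  field
    top : ℕ
    len : ℕ
    len≤top : len ≤ top
open Row public

l : Row → ℕ
l R = len R

size : Row → ℕ
size R = top R ∸ len R

_⁺ : Row → Row
(a / b ∣ p) ⁺ = suc a / suc b ∣ Data.Nat.s≤s p

-- |R ∩ R'| : cells j with max(b,b')+1 ≤ j ≤ min(a,a')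
∣_∩_∣ : Row → Row → ℕ
∣ R ∩ R' ∣ = (top R ⊓ top R') ∸ (len R ⊔ len R')

M : Row → Row → ℕ
M R R' with len R ≤? len R'
... | yes _ = ∣ R ∩ R' ∣
... | no  _ = ∣ R ∩ (R' ⁺) ∣

_↔R_ : Row → Row → Set
R ↔R R' = M R R' ≡ M R' R

_↮R_ : Row → Row → Set
R ↮R R' = ¬ (R ↔R R')

-- horizontal strip of n rows R_1..R_n (indexed by Fin n, index i ↦ R_{i+1})
HStrip : ℕ → Set
HStrip n = Fin n → Row

Mᵢⱼ : ∀ {n} → HStrip n → Fin n → Fin n → ℕ
Mᵢⱼ λs i j with toℕ i ≤? toℕ j
... | yes _ = M (λs i) (λs j)
... | no  _ = M (λs j) (λs i)

-- isomorphism Π(λ) → Π(μ): permutation φ of {1..n} preserving sizes and M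
IsIso : ∀ {n} → HStrip n → HStrip n → (Fin n ↔ Fin n) → Set
IsIso {n} λs μs φ =
  ((t : Fin n) → size (λs t) ≡ size (μs (f t))) ×
  ((s t : Fin n) → ¬ (s ≡ t) → Mᵢⱼ λs s t ≡ Mᵢⱼ μs (f s) (f t))
  where f = Inverse.to φ

{-# OPTIONS --safe #-}
module Submission where

-- If l(R) < l(R′) and R ↮ R′, the rows interlace: l(R) < l(R′) ≤ top R < top R′, and then
-- M(R,R′) = top R − l(R′).  This gives strict "triangle" inequalities in λ: when R₁ interlaces
-- both R₂ and R₃, M₂₃ > min(M₁₂, M₁₃); when R₁ and R₂ both interlace R₃, M₁₂ > min(M₁₃, M₂₃).
-- In μ nothing is known about the positions φᵢ, but whatever the order, M(S,S′) is squeezed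
-- between |S ∩ S′| and (1 + top S ⊓ top S′) − (l S ⊔ l S′).  If the lengths in μ were in the
-- wrong order, these bounds and the preserved sizes would force the reverse non-strict
-- inequality, a contradiction.

open import Defs
open import Data.Fin using (Fin; zero; suc; toℕ)
open import Data.Nat using (ℕ; suc; _<_; _>_; _≤_; _∸_; _⊓_; _⊔_; s≤s)
open import Data.Nat.Properties
open import Data.Product using (_×_; _,_; proj₁; proj₂)
open import Data.Sum using ([_,_])
open import Function.Bundles using (_↔_; Inverse)
open import Relation.Binary.PropositionalEquality
  using (_≡_; _≢_; sym; trans; cong; cong₂; subst; module ≡-Reasoning)
open import Relation.Nullary using (yes; no; contradiction)

M-< : ∀ {R R′} → l R < l R′ → M R R′ ≡ (top R ⊓ top R′) ∸ l R′
M-< {R} {R′} b<b′ with len R ≤? len R′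
... | yes _    = cong ((top R ⊓ top R′) ∸_) (m≤n⇒m⊔n≡n (<⇒≤ b<b′))
... | no b≰b′ = contradiction (<⇒≤ b<b′) b≰b′

M-> : ∀ {R R′} → l R′ < l R → M R R′ ≡ (top R ⊓ suc (top R′)) ∸ l R
M-> {R} {R′} b′<b with len R ≤? len R′
... | yes b≤b′ = contradiction b≤b′ (<⇒≱ b′<b)
... | no _     = cong ((top R ⊓ suc (top R′)) ∸_) (m≥n⇒m⊔n≡m b′<b)

nested⇒↔R : ∀ {R R′} → l R < l R′ → top R′ ≤ top R → R ↔R R′
nested⇒↔R {R} {R′} b<b′ a′≤a = begin
  M R R′                       ≡⟨ M-< b<b′ ⟩
  (top R ⊓ top R′) ∸ l R′      ≡⟨ cong (_∸ l R′) (m≥n⇒m⊓n≡n a′≤a) ⟩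
  top R′ ∸ l R′                ≡⟨ cong (_∸ l R′) (m≤n⇒m⊓n≡m (m≤n⇒m≤1+n a′≤a)) ⟨
  (top R′ ⊓ suc (top R)) ∸ l R′ ≡⟨ M-> b<b′ ⟨
  M R′ R                       ∎
  where open ≡-Reasoning

disjoint⇒↔R : ∀ {R R′} → l R < l R′ → top R < l R′ → R ↔R R′
disjoint⇒↔R {R} {R′} b<b′ a<b′ = trans
  (trans (M-< b<b′) (m≤n⇒m∸n≡0 (≤-trans (m⊓n≤m (top R) (top R′)) (<⇒≤ a<b′))))
  (sym (trans (M-> b<b′) (m≤n⇒m∸n≡0 (≤-trans (m⊓n≤n (top R′) (suc (top R))) a<b′))))

record Interlaced (R R′ : Row) : Set where
  field
    l<l′     : l R < l R′
    l′≤top   : l R′ ≤ top R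
    top<top′ : top R < top R′
open Interlaced

↮R⇒interlaced : ∀ {R R′} → l R < l R′ → R ↮R R′ → Interlaced R R′
↮R⇒interlaced {R} {R′} b<b′ R↮R′ with top R′ ≤? top R | len R′ ≤? top R
... | yes a′≤a | _        = contradiction (nested⇒↔R b<b′ a′≤a) R↮R′
... | no _     | no b′≰a = contradiction (disjoint⇒↔R b<b′ (≰⇒> b′≰a)) R↮R′
... | no a′≰a | yes b′≤a = record { l<l′ = b<b′ ; l′≤top = b′≤a ; top<top′ = ≰⇒> a′≰a }

module _ {R R′ : Row} (I : Interlaced R R′) where

  ∣∩∣-interlaced : ∣ R ∩ R′ ∣ ≡ top R ∸ l R′
  ∣∩∣-interlaced = cong₂ _∸_ (m≤n⇒m⊓n≡m (<⇒≤ (top<top′ I))) (m≤n⇒m⊔n≡n (<⇒≤ (l<l′ I)))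

  M-interlaced : M R R′ ≡ top R ∸ l R′
  M-interlaced = trans (M-< (l<l′ I)) (cong (_∸ l R′) (m≤n⇒m⊓n≡m (<⇒≤ (top<top′ I))))

  M-interlaced<sizeˡ : M R R′ < size R
  M-interlaced<sizeˡ =
    subst (_< size R) (sym M-interlaced) (∸-monoʳ-< (l<l′ I) (l′≤top I))

  M-interlaced<sizeʳ : M R R′ < size R′
  M-interlaced<sizeʳ =
    subst (_< size R′) (sym M-interlaced) (∸-monoˡ-< (top<top′ I) (l′≤top I))

record MBounds (R R′ : Row) (m : ℕ) : Set where
  field
    lower : ∣ R ∩ R′ ∣ ≤ m
    upper : m ≤ suc (top R ⊓ top R′) ∸ (l R ⊔ l R′)
open MBounds

MBounds-sym : ∀ {R R′ m} → MBounds R R′ m → MBounds R′ R m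
MBounds-sym {R} {R′} {m} B = record
  { lower = subst (_≤ m) (cong₂ _∸_ ⊓-swap ⊔-swap) (lower B)
  ; upper = subst (m ≤_) (cong₂ (λ a b → suc a ∸ b) ⊓-swap ⊔-swap) (upper B)
  }
  where
  ⊓-swap : top R ⊓ top R′ ≡ top R′ ⊓ top R
  ⊓-swap = ⊓-comm (top R) (top R′)
  ⊔-swap : l R ⊔ l R′ ≡ l R′ ⊔ l R
  ⊔-swap = ⊔-comm (l R) (l R′)

M-bounds : ∀ R R′ → MBounds R R′ (M R R′)
M-bounds R R′ with len R ≤? len R′
... | yes _ = record
  { lower = ≤-refl
  ; upper = ∸-monoˡ-≤ (l R ⊔ l R′) (n≤1+n (top R ⊓ top R′))
  }
... | no b≰b′ = record
  { lower = ∸-mono (⊓-monoʳ-≤ (top R) (n≤1+n (top R′)))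
                   (⊔-lub (m≤m⊔n (l R) (l R′)) (≤-trans (≰⇒> b≰b′) (m≤m⊔n (l R) (l R′))))
  ; upper = ∸-mono (⊓-monoˡ-≤ (suc (top R′)) (n≤1+n (top R))) (⊔-monoʳ-≤ (l R) (n≤1+n (l R′)))
  }

Mᵢⱼ-bounds : ∀ {n} (μs : HStrip n) i j → MBounds (μs i) (μs j) (Mᵢⱼ μs i j)
Mᵢⱼ-bounds μs i j with toℕ i ≤? toℕ j
... | yes _ = M-bounds (μs i) (μs j)
... | no _  = MBounds-sym (M-bounds (μs j) (μs i))

MBounds-upper : ∀ {R R′ m} → MBounds R R′ m → m ≤ suc (top R) ∸ l R′
MBounds-upper {R} {R′} B =
  ≤-trans (upper B) (∸-mono (s≤s (m⊓n≤m (top R) (top R′))) (m≤n⊔m (l R) (l R′)))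

MBounds<size⇒top′<top : ∀ {R R′ m} → l R′ ≤ l R → MBounds R R′ m → m < size R →
                        top R′ < top R × top R′ ∸ l R ≤ m
MBounds<size⇒top′<top {R} {R′} {m} b′≤b B m<size with top R ≤? top R′
... | yes a≤a′ = contradiction
  (subst (_≤ m) (cong₂ _∸_ (m≤n⇒m⊓n≡m a≤a′) (m≥n⇒m⊔n≡m b′≤b)) (lower B)) (<⇒≱ m<size)
... | no a≰a′ = a′<a
  , subst (_≤ m) (cong₂ _∸_ (m≥n⇒m⊓n≡n (<⇒≤ a′<a)) (m≥n⇒m⊔n≡m b′≤b)) (lower B)
  where
  a′<a : top R′ < top R
  a′<a = ≰⇒> a≰a′

interlaced-fanOut : ∀ {x₁ x₂ x₃} → Interlaced x₁ x₂ → Interlaced x₁ x₃ →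
                    M x₁ x₂ ⊓ M x₁ x₃ < M x₂ x₃
interlaced-fanOut {x₁} {x₂} {x₃} I₁₂ I₁₃ = begin-strict
  M x₁ x₂ ⊓ M x₁ x₃                 ≡⟨ cong₂ _⊓_ (M-interlaced I₁₂) (M-interlaced I₁₃) ⟩
  (top x₁ ∸ l x₂) ⊓ (top x₁ ∸ l x₃) ≡⟨ ∸-distribˡ-⊔-⊓ (top x₁) (l x₂) (l x₃) ⟨
  top x₁ ∸ (l x₂ ⊔ l x₃)            <⟨ ∸-monoˡ-< (⊓-glb (top<top′ I₁₂) (top<top′ I₁₃))
                                                  (⊔-lub (l′≤top I₁₂) (l′≤top I₁₃)) ⟩
  (top x₂ ⊓ top x₃) ∸ (l x₂ ⊔ l x₃) ≤⟨ lower (M-bounds x₂ x₃) ⟩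
  M x₂ x₃                           ∎
  where open ≤-Reasoning

interlaced-fanIn : ∀ {x₁ x₂ x₃} → Interlaced x₁ x₃ → Interlaced x₂ x₃ →
                   M x₁ x₃ ⊓ M x₂ x₃ < M x₁ x₂
interlaced-fanIn {x₁} {x₂} {x₃} I₁₃ I₂₃ = begin-strict
  M x₁ x₃ ⊓ M x₂ x₃                 ≡⟨ cong₂ _⊓_ (M-interlaced I₁₃) (M-interlaced I₂₃) ⟩
  (top x₁ ∸ l x₃) ⊓ (top x₂ ∸ l x₃) ≡⟨ ∸-distribʳ-⊓ (l x₃) (top x₁) (top x₂) ⟨
  (top x₁ ⊓ top x₂) ∸ l x₃          <⟨ ∸-monoʳ-< (⊔-lub (l<l′ I₁₃) (l<l′ I₂₃))
                                                  (⊓-glb (l′≤top I₁₃) (l′≤top I₂₃)) ⟩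
  (top x₁ ⊓ top x₂) ∸ (l x₁ ⊔ l x₂) ≤⟨ lower (M-bounds x₁ x₂) ⟩
  M x₁ x₂                           ∎
  where open ≤-Reasoning

fanOut-bound : ∀ {y₁ y₂ y₃ m₁₂ m₁₃ m₂₃} → Interlaced y₁ y₃ → l y₂ ≤ l y₁ →
               MBounds y₁ y₂ m₁₂ → MBounds y₁ y₃ m₁₃ → MBounds y₂ y₃ m₂₃ →
               m₁₂ < size y₁ → m₂₃ ≤ m₁₂ ⊓ m₁₃
fanOut-bound {y₁} {y₂} {y₃} {m₁₂} {m₁₃} {m₂₃} J d₂≤d₁ B₁₂ B₁₃ B₂₃ m₁₂<size =
  ⊓-glb (begin
           m₂₃                 ≤⟨ MBounds-upper B₂₃ ⟩
           suc (top y₂) ∸ l y₃ ≤⟨ ∸-monoʳ-≤ (suc (top y₂)) (l<l′ J) ⟩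
           top y₂ ∸ l y₁       ≤⟨ c₂∸d₁≤m₁₂ ⟩
           m₁₂                 ∎)
        (begin
           m₂₃                 ≤⟨ MBounds-upper B₂₃ ⟩
           suc (top y₂) ∸ l y₃ ≤⟨ ∸-monoˡ-≤ (l y₃) c₂<c₁ ⟩
           top y₁ ∸ l y₃       ≡⟨ ∣∩∣-interlaced J ⟨
           ∣ y₁ ∩ y₃ ∣         ≤⟨ lower B₁₃ ⟩
           m₁₃                 ∎)
  where
  open ≤-Reasoning
  top-bound : top y₂ < top y₁ × top y₂ ∸ l y₁ ≤ m₁₂
  top-bound = MBounds<size⇒top′<top d₂≤d₁ B₁₂ m₁₂<size
  c₂<c₁ : top y₂ < top y₁
  c₂<c₁ = proj₁ top-bound
  c₂∸d₁≤m₁₂ : top y₂ ∸ l y₁ ≤ m₁₂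
  c₂∸d₁≤m₁₂ = proj₂ top-bound

fanIn-bound : ∀ {y₁ y₂ y₃ m₁₂ m₁₃ m₂₃} → Interlaced y₁ y₃ → l y₃ ≤ l y₂ →
              MBounds y₁ y₂ m₁₂ → MBounds y₁ y₃ m₁₃ → MBounds y₂ y₃ m₂₃ →
              m₂₃ < size y₂ → m₂₃ < size y₃ → m₁₂ ≤ m₁₃ ⊓ m₂₃
fanIn-bound {y₁} {y₂} {y₃} {m₁₂} {m₁₃} {m₂₃} J d₃≤d₂ B₁₂ B₁₃ B₂₃ m₂₃<size₂ m₂₃<size₃ =
  [ strictly-shorter , equally-long ] (m≤n⇒m<n∨m≡n d₃≤d₂)
  where
  open ≤-Reasoning
  c₃∸d₂≤m₂₃ : top y₃ ∸ l y₂ ≤ m₂₃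
  c₃∸d₂≤m₂₃ = proj₂ (MBounds<size⇒top′<top d₃≤d₂ B₂₃ m₂₃<size₂)

  strictly-shorter : l y₃ < l y₂ → m₁₂ ≤ m₁₃ ⊓ m₂₃
  strictly-shorter d₃<d₂ =
    ⊓-glb (begin
             m₁₂                 ≤⟨ MBounds-upper B₁₂ ⟩
             suc (top y₁) ∸ l y₂ ≤⟨ ∸-monoʳ-≤ (suc (top y₁)) d₃<d₂ ⟩
             top y₁ ∸ l y₃       ≡⟨ ∣∩∣-interlaced J ⟨
             ∣ y₁ ∩ y₃ ∣         ≤⟨ lower B₁₃ ⟩
             m₁₃                 ∎)
          (begin
             m₁₂                 ≤⟨ MBounds-upper B₁₂ ⟩
             suc (top y₁) ∸ l y₂ ≤⟨ ∸-monoˡ-≤ (l y₂) (top<top′ J) ⟩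
             top y₃ ∸ l y₂       ≤⟨ c₃∸d₂≤m₂₃ ⟩
             m₂₃                 ∎)

  equally-long : l y₃ ≡ l y₂ → m₁₂ ≤ m₁₃ ⊓ m₂₃
  equally-long d₃≡d₂ =
    contradiction (subst (λ d → top y₃ ∸ d ≤ m₂₃) (sym d₃≡d₂) c₃∸d₂≤m₂₃) (<⇒≱ m₂₃<size₃)

fanOut-transfer : ∀ {x₁ x₂ x₃ y₁ y₂ y₃} →
                  Interlaced x₁ x₂ → Interlaced x₁ x₃ → Interlaced y₁ y₃ → size x₁ ≡ size y₁ →
                  MBounds y₁ y₂ (M x₁ x₂) → MBounds y₁ y₃ (M x₁ x₃) → MBounds y₂ y₃ (M x₂ x₃) →
                  l y₁ < l y₂
fanOut-transfer {x₁} {x₂} {y₁ = y₁} {y₂} I₁₂ I₁₃ J₁₃ size₁ B₁₂ B₁₃ B₂₃ with len y₂ ≤? len y₁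
... | no d₂≰d₁  = ≰⇒> d₂≰d₁
... | yes d₂≤d₁ = contradiction
  (fanOut-bound J₁₃ d₂≤d₁ B₁₂ B₁₃ B₂₃ (subst (M x₁ x₂ <_) size₁ (M-interlaced<sizeˡ I₁₂)))
  (<⇒≱ (interlaced-fanOut I₁₂ I₁₃))

fanIn-transfer : ∀ {x₁ x₂ x₃ y₁ y₂ y₃} →
                 Interlaced x₁ x₃ → Interlaced x₂ x₃ → Interlaced y₁ y₃ →
                 size x₂ ≡ size y₂ → size x₃ ≡ size y₃ →
                 MBounds y₁ y₂ (M x₁ x₂) → MBounds y₁ y₃ (M x₁ x₃) → MBounds y₂ y₃ (M x₂ x₃) →
                 l y₂ < l y₃
fanIn-transfer {x₂ = x₂} {x₃} {y₂ = y₂} {y₃} I₁₃ I₂₃ J₁₃ size₂ size₃ B₁₂ B₁₃ B₂₃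
  with len y₃ ≤? len y₂
... | no d₃≰d₂  = ≰⇒> d₃≰d₂
... | yes d₃≤d₂ = contradiction
  (fanIn-bound J₁₃ d₃≤d₂ B₁₂ B₁₃ B₂₃ (subst (M x₂ x₃ <_) size₂ (M-interlaced<sizeˡ I₂₃))
                                     (subst (M x₂ x₃ <_) size₃ (M-interlaced<sizeʳ I₂₃)))
  (<⇒≱ (interlaced-fanIn I₁₃ I₂₃))

proposition5p11 : (k : ℕ) → (λs μs : HStrip (suc (suc (suc k)))) →
    (φ : Fin (suc (suc (suc k))) ↔ Fin (suc (suc (suc k)))) →
    let R₁ = λs zero
        R₂ = λs (suc zero)
        R₃ = λs (suc (suc zero))
        φ₁ = Inverse.to φ zero
        φ₂ = Inverse.to φ (suc zero)
        φ₃ = Inverse.to φ (suc (suc zero))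
    in
    l R₁ < l R₃ → R₁ ↮R R₃ →
    IsIso λs μs φ →
    toℕ φ₁ < toℕ φ₃ → l (μs φ₁) < l (μs φ₃) → μs φ₁ ↮R μs φ₃ →
    ((l R₂ > l R₁ → R₁ ↮R R₂ → l (μs φ₂) > l (μs φ₁)) ×
     (l R₃ > l R₂ → R₂ ↮R R₃ → l (μs φ₃) > l (μs φ₂)))
proposition5p11 k λs μs φ l₁<l₃ R₁↮R₃ (sizes , Ms) _ k₁<k₃ S₁↮S₃ =
    (λ l₁<l₂ R₁↮R₂ → fanOut-transfer (↮R⇒interlaced l₁<l₂ R₁↮R₂) I₁₃ J₁₃ (sizes zero)
                       (bounds zero (suc zero) (λ ()))
                       (bounds zero (suc (suc zero)) (λ ()))
                       (bounds (suc zero) (suc (suc zero)) (λ ())))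
  , (λ l₂<l₃ R₂↮R₃ → fanIn-transfer I₁₃ (↮R⇒interlaced l₂<l₃ R₂↮R₃) J₁₃
                       (sizes (suc zero)) (sizes (suc (suc zero)))
                       (bounds zero (suc zero) (λ ()))
                       (bounds zero (suc (suc zero)) (λ ()))
                       (bounds (suc zero) (suc (suc zero)) (λ ())))
  where
  f : Fin (suc (suc (suc k))) → Fin (suc (suc (suc k)))
  f = Inverse.to φ
  I₁₃ : Interlaced (λs zero) (λs (suc (suc zero)))
  I₁₃ = ↮R⇒interlaced l₁<l₃ R₁↮R₃
  J₁₃ : Interlaced (μs (f zero)) (μs (f (suc (suc zero))))
  J₁₃ = ↮R⇒interlaced k₁<k₃ S₁↮S₃
  bounds : ∀ s t → s ≢ t → MBounds (μs (f s)) (μs (f t)) (Mᵢⱼ λs s t)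
  bounds s t s≢t =
    subst (MBounds (μs (f s)) (μs (f t))) (sym (Ms s t s≢t)) (Mᵢⱼ-bounds μs (f s) (f t))
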